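{- Let $M=(Q,q_0,\delta,F)$ be a nondeterministic Büchi word acceptor, $q\in F$, and $L$ an $\omega$-language recognized by a deterministic Büchi word acceptor $T_L$. Suppose $v_1,v_2,\dots,v_n\in L_{q,q}$ are such that $L_{q_0,q}\cdot(v_1v_2\cdots v_n\cdot L_{q,q})^\omega\setminus L\neq\emptyset$, and suppose the number of states of $T_L$ is less than $n$. Then there exist integers $i,j$ with $1\le i\le j\le n$ such that $L_{q_0,q}\cdot(v_iv_{i+1}\cdots v_j)^\omega\setminus L\neq\emptyset$.
   Context: $\Sigma$ finite alphabet. $L_{q_0,q}$ is the set of finite words $x$ such that some run of $M$ on $x$ from $q_0$ ends in $q$; $L_{q,q}$ is the set of nonempty finite words $x$ such that some run of $M$ on $x$ starting in $q$ ends in $q$. For $S\subseteq\Sigma^*$, $S^\omega$ is the set of $\omega$-words $s_1s_2\cdots$ with $s_i\in S\setminus\{\varepsilon\}$; for a single word $w$, $(w)^\omega=\{w\}^\omega$. -}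

module Defs where

open import Data.Nat using (ℕ; zero; suc; _≤_; _<_; _∸_)
open import Data.Fin using (Fin)
open import Data.Bool using (Bool; true)
open import Data.List using (List; []; _∷_; _++_)
open import Data.List.NonEmpty using (List⁺; _∷_; toList)
open import Data.Product using (Σ; ∃; _×_; _,_)
open import Relation.Binary.PropositionalEquality using (_≡_)
open import Relation.Nullary using (¬_)

ωWord : Set → Set
ωWord A = ℕ → A

record NBA (k : ℕ) : Set where
  field
    states : ℕ
    q₀     : Fin states
    δ      : Fin states → Fin k → Fin states → Bool
    F      : Fin states → Bool

data Reach {k : ℕ} (M : NBA k) : Fin (NBA.states M) → List (Fin k) → Fin (NBA.states M) → Set where
  reach-[] : ∀ {q} → Reach M q [] q
  reach-∷  : ∀ {q q′ r a x} → NBA.δ M q a q′ ≡ true → Reach M q′ x r → Reach M q (a ∷ x) r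

Lq0 : ∀ {k} (M : NBA k) → Fin (NBA.states M) → List (Fin k) → Set
Lq0 M q x = Reach M (NBA.q₀ M) x q

Lqq : ∀ {k} (M : NBA k) → Fin (NBA.states M) → List (Fin k) → Set
Lqq M q x = Reach M q x q × ¬ (x ≡ [])

record DBA (k : ℕ) : Set where
  field
    states : ℕ
    init   : Fin states
    δ      : Fin states → Fin k → Fin states
    F      : Fin states → Bool

run : ∀ {k} (T : DBA k) → ωWord (Fin k) → ℕ → Fin (DBA.states T)
run T α zero    = DBA.init T
run T α (suc i) = DBA.δ T (run T α i) (α i)

Accepts : ∀ {k} (T : DBA k) → ωWord (Fin k) → Set
Accepts T α = ∀ N → ∃ λ i → N ≤ i × DBA.F T (run T α i) ≡ true

concatω : ∀ {A : Set} → List⁺ A → (ℕ → List⁺ A) → ℕ → A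
concatω (x ∷ [])       s zero    = x
concatω (x ∷ [])       s (suc n) = concatω (s 0) (λ i → s (suc i)) n
concatω (x ∷ (y ∷ ys)) s zero    = x
concatω (x ∷ (y ∷ ys)) s (suc n) = concatω (y ∷ ys) s n

concatSeq : ∀ {A : Set} → (ℕ → List⁺ A) → ωWord A
concatSeq s = concatω (s 0) (λ i → s (suc i))

_^ω : ∀ {A : Set} → (List A → Set) → ωWord A → Set
_^ω {A} S α = ∃ λ (s : ℕ → List⁺ A) → (∀ i → S (toList (s i))) × (∀ n → α n ≡ concatSeq s n)

_++ω_ : ∀ {A : Set} → List A → ωWord A → ωWord A
([] ++ω β) n = β n
((a ∷ u) ++ω β) zero    = a
((a ∷ u) ++ω β) (suc n) = (u ++ω β) n

_·ω_ : ∀ {A : Set} → (List A → Set) → (ωWord A → Set) → ωWord A → Set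
(S ·ω T) α = ∃ λ u → ∃ λ β → S u × T β × (∀ n → α n ≡ (u ++ω β) n)

_·_ : ∀ {A : Set} → List A → (List A → Set) → List A → Set
(w · S) x = ∃ λ y → S y × x ≡ w ++ y

⟦_⟧ : ∀ {A : Set} → List A → List A → Set
⟦ w ⟧ x = x ≡ w

-- seg v i l = v_i v_{i+1} ⋯ v_{i+l-1}
seg : ∀ {A : Set} → (ℕ → List A) → ℕ → ℕ → List A
seg v i zero    = []
seg v i (suc l) = v i ++ seg v (suc i) l

-- v_i ⋯ v_j  (for i ≤ j)
infixWord : ∀ {A : Set} → (ℕ → List A) → ℕ → ℕ → List A
infixWord v i j = seg v i (suc (j ∸ i))

NonemptyMinus : ∀ {k} → (ωWord (Fin k) → Set) → DBA k → Set
NonemptyMinus X T = ∃ λ α → X α × ¬ Accepts T α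

module Submission where

-- For every state p of T the n + 1 prefixes v₁ ⋯ v_l (l ≤ n) cannot all lead
-- from p to distinct states, so some infix w = v_{a+1} ⋯ v_c brings T from
-- r = δ*(p, v₁ ⋯ v_a) back to r.  If for some p reached by T on a word u of
-- L_{q₀,q} the loop w passes no accepting state, then u v₁ ⋯ v_a w^ω is the
-- required counterexample.  Otherwise every block v₁ ⋯ v_n y of the given
-- rejected word contains such a loop read from a reachable state, so the word
-- is accepted after all.  The case distinction is decidable because
-- reachability in the product of M and T is.

open import Defs
open import Data.Nat using (ℕ; zero; suc; _≤_; _<_; _+_; _∸_; z≤n; s≤s; _<?_)
open import Data.Nat.Properties
open import Data.Nat.Induction using (<-rec)
open import Data.Fin using (Fin; toℕ)
import Data.Fin as Fin
open import Data.Fin.Properties using (any?; pigeonhole; toℕ<n; *↔×)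
open import Data.Fin.Subset using (Subset; _∈_; _∉_; _∪_; ⁅_⁆; ∣_∣)
open import Data.Fin.Subset.Properties
  using (_∈?_; x∈⁅x⁆; x∈⁅y⁆⇒x≡y; x∈p∪q⁻; p⊆p∪q; q⊆p∪q; ∣p∣≤n; p⊂q⇒∣p∣<∣q∣)
open import Data.Bool using (true)
import Data.Bool.Properties as Bool
open import Data.List using (List; []; _∷_; _++_; length)
open import Data.List.Properties using (++-assoc)
open import Data.List.NonEmpty using (List⁺; _∷_; toList)
open import Data.List.Relation.Unary.Any using (Any; here; there)
import Data.List.Relation.Unary.Any as Any
open import Data.List.Relation.Unary.Any.Properties using (++⁺ˡ; ++⁺ʳ)
open import Data.Product using (∃; ∃₂; _×_; _,_; proj₁; proj₂)
open import Data.Sum using (inj₁; inj₂)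
open import Data.Empty using (⊥-elim)
open import Function using (_∘_)
open import Function.Bundles using (_↔_; Inverse)
open import Level using (0ℓ)
open import Relation.Binary using (Rel; Decidable)
open import Relation.Binary.Construct.Closure.ReflexiveTransitive using (Star; ε; _◅_; _◅◅_; gmap)
open import Relation.Binary.PropositionalEquality
open import Relation.Nullary using (Dec; yes; no; ¬_; contradiction)
open import Relation.Nullary.Decidable using (_×-dec_; ¬?; map′; decidable-stable)

-- Reachability in a finite graph is decidable

module _ {n : ℕ} {R : Rel (Fin n) 0ℓ} where

  Closed : Subset n → Set
  Closed S = ∀ {x y} → x ∈ S → R x y → y ∈ S

  Star-closed : ∀ {S x y} → Closed S → x ∈ S → Star R x y → y ∈ S
  Star-closed closed x∈S ε        = x∈S
  Star-closed closed x∈S (r ◅ rs) = Star-closed closed (closed x∈S r) rs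

  Exit : Subset n → Set
  Exit S = ∃₂ λ x y → x ∈ S × R x y × y ∉ S

  exit? : Decidable R → ∀ S → Dec (Exit S)
  exit? R? S = any? λ x → any? λ y → x ∈? S ×-dec R? x y ×-dec ¬? (y ∈? S)

  ¬Exit⇒Closed : ∀ {S} → ¬ Exit S → Closed S
  ¬Exit⇒Closed {S} ¬exit {x} {y} x∈S r with y ∈? S
  ... | yes y∈S = y∈S
  ... | no  y∉S = contradiction (x , y , x∈S , r , y∉S) ¬exit

  ReachableFrom : Fin n → Subset n → Set
  ReachableFrom s S = ∀ {y} → y ∈ S → Star R s y

  -- Adding an exit target strictly enlarges S, so n + 1 rounds of fuel suffice.
  saturate : Decidable R → ∀ {s} fuel S → n < ∣ S ∣ + fuel → s ∈ S → ReachableFrom s S →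
             ∃ λ S′ → s ∈ S′ × ReachableFrom s S′ × Closed S′
  saturate R? zero S bound _ _ =
    ⊥-elim (<-irrefl refl (<-≤-trans bound (≤-trans (≤-reflexive (+-identityʳ _)) (∣p∣≤n S))))
  saturate R? (suc fuel) S bound s∈S reach with exit? R? S
  ... | no ¬exit = S , s∈S , reach , ¬Exit⇒Closed ¬exit
  ... | yes (x , y , x∈S , r , y∉S) =
    saturate R? fuel (S ∪ ⁅ y ⁆) bound′ (p⊆p∪q ⁅ y ⁆ s∈S) reach′
    where
    grows : ∣ S ∣ < ∣ S ∪ ⁅ y ⁆ ∣
    grows = p⊂q⇒∣p∣<∣q∣ (p⊆p∪q ⁅ y ⁆ , y , q⊆p∪q S ⁅ y ⁆ (x∈⁅x⁆ y) , y∉S)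
    bound′ : n < ∣ S ∪ ⁅ y ⁆ ∣ + fuel
    bound′ = <-≤-trans bound (≤-trans (≤-reflexive (+-suc ∣ S ∣ fuel)) (+-monoˡ-≤ fuel grows))
    reach′ : ReachableFrom _ (S ∪ ⁅ y ⁆)
    reach′ {z} z∈ with x∈p∪q⁻ S ⁅ y ⁆ z∈
    ... | inj₁ z∈S = reach z∈S
    ... | inj₂ z∈y rewrite x∈⁅y⁆⇒x≡y y z∈y = reach x∈S ◅◅ (r ◅ ε)

  Star? : Decidable R → Decidable (Star R)
  Star? R? s y with saturate R? (suc n) ⁅ s ⁆ (m≤n+m (suc n) ∣ ⁅ s ⁆ ∣) (x∈⁅x⁆ s) singleton
    where
    singleton : ReachableFrom s ⁅ s ⁆
    singleton y∈ rewrite x∈⁅y⁆⇒x≡y s y∈ = ε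
  ... | S , s∈S , reach , closed with y ∈? S
  ...   | yes y∈S = yes (reach y∈S)
  ...   | no  y∉S = no (y∉S ∘ Star-closed closed s∈S)

Star?-↔ : ∀ {N} {X : Set} {R : Rel X 0ℓ} → Fin N ↔ X → Decidable R → Decidable (Star R)
Star?-↔ {R = R} e R? x y =
  map′ back forth (Star? (λ i j → R? (to i) (to j)) (from x) (from y))
  where
  open Inverse e
  R′ : Rel (Fin _) 0ℓ
  R′ i j = R (to i) (to j)
  forth : Star R x y → Star R′ (from x) (from y)
  forth = gmap from λ {a} {b} r → subst₂ R (sym (strictlyInverseˡ a)) (sym (strictlyInverseˡ b)) r
  back : Star R′ (from x) (from y) → Star R x y
  back st = subst₂ (Star R) (strictlyInverseˡ x) (strictlyInverseˡ y) (gmap to (λ r → r) st)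

-- Runs of a deterministic automaton

module _ {k : ℕ} (T : DBA k) where
  open DBA T

  δ* : Fin states → List (Fin k) → Fin states
  δ* p []      = p
  δ* p (c ∷ x) = δ* (δ p c) x

  δ*-++ : ∀ p x y → δ* p (x ++ y) ≡ δ* (δ* p x) y
  δ*-++ p []      y = refl
  δ*-++ p (c ∷ x) y = δ*-++ (δ p c) x y

  -- The state before each letter of x; the final state δ* p x is not listed.
  trace : Fin states → List (Fin k) → List (Fin states)
  trace p []      = []
  trace p (c ∷ x) = p ∷ trace (δ p c) x

  trace-++ : ∀ p x y → trace p (x ++ y) ≡ trace p x ++ trace (δ* p x) y
  trace-++ p []      y = refl
  trace-++ p (c ∷ x) y = cong (p ∷_) (trace-++ (δ p c) x y)

  Accepting : Fin states → Set
  Accepting r = F r ≡ true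

  Visits : Fin states → List (Fin k) → Set
  Visits p x = Any Accepting (trace p x)

  Visits? : ∀ p x → Dec (Visits p x)
  Visits? p x = Any.any? (λ r → F r Bool.≟ true) (trace p x)

  Visits-++⁺ˡ : ∀ {p} x y → Visits p x → Visits p (x ++ y)
  Visits-++⁺ˡ {p} x y v = subst (Any Accepting) (sym (trace-++ p x y)) (++⁺ˡ v)

  Visits-++⁺ʳ : ∀ {p} x y → Visits (δ* p x) y → Visits p (x ++ y)
  Visits-++⁺ʳ {p} x y v = subst (Any Accepting) (sym (trace-++ p x y)) (++⁺ʳ (trace p x) v)

  startAt : Fin states → DBA k
  startAt p = record T { init = p }

  run-cong : ∀ {α β} → (∀ i → α i ≡ β i) → ∀ i → run T α i ≡ run T β i
  run-cong α≗β zero    = refl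
  run-cong α≗β (suc i) = cong₂ δ (run-cong α≗β i) (α≗β i)

  Accepts-cong : ∀ {α β} → (∀ i → α i ≡ β i) → Accepts T α → Accepts T β
  Accepts-cong α≗β acc N with acc N
  ... | i , N≤i , accepting = i , N≤i , subst Accepting (run-cong α≗β i) accepting

  run-tail : ∀ p α i → run (startAt p) α (suc i) ≡ run (startAt (δ p (α 0))) (α ∘ suc) i
  run-tail p α zero    = refl
  run-tail p α (suc i) = cong (λ r → δ r (α (suc i))) (run-tail p α i)

  run-++ω : ∀ p x β i → run (startAt p) (x ++ω β) (length x + i) ≡ run (startAt (δ* p x)) β i
  run-++ω p []      β i = refl
  run-++ω p (c ∷ x) β i = trans (run-tail p ((c ∷ x) ++ω β) (length x + i)) (run-++ω (δ p c) x β i)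

  Visits⇒accepting : ∀ {p} x β → Visits p x → ∃ λ i → Accepting (run (startAt p) (x ++ω β) i)
  Visits⇒accepting     (c ∷ x) β (here accepting) = 0 , accepting
  Visits⇒accepting {p} (c ∷ x) β (there v) with Visits⇒accepting x β v
  ... | i , accepting = suc i , subst Accepting (sym (run-tail p ((c ∷ x) ++ω β) i)) accepting

  accepting⇒Visits : ∀ {p} x β i → i < length x → Accepting (run (startAt p) (x ++ω β) i) → Visits p x
  accepting⇒Visits     (c ∷ x) β zero    _         accepting = here accepting
  accepting⇒Visits {p} (c ∷ x) β (suc i) (s≤s i<x) accepting =
    there (accepting⇒Visits x β i i<x (subst Accepting (run-tail p ((c ∷ x) ++ω β) i) accepting))

  Accepts-++ω⁺ : ∀ p x β → Accepts (startAt (δ* p x)) β → Accepts (startAt p) (x ++ω β)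
  Accepts-++ω⁺ p x β acc N with acc N
  ... | i , N≤i , accepting =
    length x + i , ≤-trans N≤i (m≤n+m i (length x)) , subst Accepting (sym (run-++ω p x β i)) accepting

  Accepts-++ω⁻ : ∀ p x β → Accepts (startAt p) (x ++ω β) → Accepts (startAt (δ* p x)) β
  Accepts-++ω⁻ p x β acc N with acc (length x + N)
  ... | i , x+N≤i , accepting with m≤n⇒∃[o]m+o≡n x+N≤i
  ...   | o , refl =
    N + o , m≤m+n N o ,
    subst Accepting (run-++ω p x β (N + o))
      (subst (Accepting ∘ run (startAt p) (x ++ω β)) (+-assoc (length x) N o) accepting)

concatω≗++ω : ∀ {A : Set} (x : List⁺ A) s i → concatω x s i ≡ (toList x ++ω concatSeq s) i
concatω≗++ω (c ∷ [])       s zero    = refl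
concatω≗++ω (c ∷ [])       s (suc i) = refl
concatω≗++ω (c ∷ (d ∷ x))  s zero    = refl
concatω≗++ω (c ∷ (d ∷ x))  s (suc i) = concatω≗++ω (d ∷ x) s i

1≤length⁺ : ∀ {A : Set} (x : List⁺ A) → 1 ≤ length (toList x)
1≤length⁺ (c ∷ x) = s≤s z≤n

cycle : ∀ {A : Set} → List⁺ A → ωWord A
cycle w = concatSeq (λ _ → w)

module _ {k : ℕ} (T : DBA k) where

  accepts-blocks : (I : Fin (DBA.states T) → Set) (s : ℕ → List⁺ (Fin k)) →
    (∀ m {p} → I p → I (δ* T p (toList (s m)))) →
    (∀ m {p} → I p → Visits T p (toList (s m))) →
    ∀ {p} → I p → Accepts (startAt T p) (concatSeq s)
  accepts-blocks I s step visits {p} Ip zero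
    with Visits⇒accepting T (toList (s 0)) (concatSeq (s ∘ suc)) (visits 0 Ip)
  ... | i , accepting =
    i , z≤n , subst (Accepting T) (sym (run-cong (startAt T p) (concatω≗++ω (s 0) (s ∘ suc)) i)) accepting
  accepts-blocks I s step visits {p} Ip (suc N)
    with accepts-blocks I (s ∘ suc) (step ∘ suc) (visits ∘ suc) (step 0 Ip) N
  ... | i , N≤i , accepting =
    length x + i , +-mono-≤ (1≤length⁺ (s 0)) N≤i ,
    subst (Accepting T)
      (sym (trans (run-cong (startAt T p) (concatω≗++ω (s 0) (s ∘ suc)) (length x + i))
                  (run-++ω T p x (concatSeq (s ∘ suc)) i)))
      accepting
    where
    x : List (Fin k)
    x = toList (s 0)

  cycle-periodic : ∀ {r} w → δ* T r (toList w) ≡ r →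
    ∀ i → run (startAt T r) (cycle w) (length (toList w) + i) ≡ run (startAt T r) (cycle w) i
  cycle-periodic {r} w loop i = begin
    run (startAt T r) (cycle w) (length (toList w) + i)
      ≡⟨ run-cong (startAt T r) (concatω≗++ω w (λ _ → w)) (length (toList w) + i) ⟩
    run (startAt T r) (toList w ++ω cycle w) (length (toList w) + i)
      ≡⟨ run-++ω T r (toList w) (cycle w) i ⟩
    run (startAt T (δ* T r (toList w))) (cycle w) i
      ≡⟨ cong (λ r′ → run (startAt T r′) (cycle w) i) loop ⟩
    run (startAt T r) (cycle w) i ∎
    where open ≡-Reasoning

  cycle-rejects : ∀ {r} w → δ* T r (toList w) ≡ r → ¬ Visits T r (toList w) →
    ∀ i → ¬ Accepting T (run (startAt T r) (cycle w) i)
  cycle-rejects {r} w loop ¬visits = <-rec _ rejects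
    where
    L : ℕ
    L = length (toList w)
    rejects : ∀ i → (∀ {j} → j < i → ¬ Accepting T (run (startAt T r) (cycle w) j)) →
              ¬ Accepting T (run (startAt T r) (cycle w) i)
    rejects i earlier accepting with i <? L
    ... | yes i<L = ¬visits (accepting⇒Visits T (toList w) (cycle w) i i<L
                      (subst (Accepting T) (run-cong (startAt T r) (concatω≗++ω w (λ _ → w)) i) accepting))
    ... | no  i≮L = earlier (subst (i ∸ L <_) L+j≡i (m<n+m (i ∸ L) (1≤length⁺ w)))
                      (subst (Accepting T) (cycle-periodic w loop (i ∸ L))
                        (subst (Accepting T ∘ run (startAt T r) (cycle w)) (sym L+j≡i) accepting))
      where
      L+j≡i : L + (i ∸ L) ≡ i
      L+j≡i = m+[n∸m]≡n (≮⇒≥ i≮L)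

-- Runs of the nondeterministic automaton, synchronised with T

module _ {k : ℕ} (M : NBA k) where

  Reach-++ : ∀ {p r r′ x y} → Reach M p x r → Reach M r y r′ → Reach M p (x ++ y) r′
  Reach-++ reach-[]       ρ′ = ρ′
  Reach-++ (reach-∷ e ρ) ρ′ = reach-∷ e (Reach-++ ρ ρ′)

  module _ (T : DBA k) where

    JointStep : Rel (Fin (NBA.states M) × Fin (DBA.states T)) 0ℓ
    JointStep (m , t) (m′ , t′) = ∃ λ c → NBA.δ M m c m′ ≡ true × DBA.δ T t c ≡ t′

    JointStep? : Decidable JointStep
    JointStep? (m , t) (m′ , t′) = any? λ c → NBA.δ M m c m′ Bool.≟ true ×-dec DBA.δ T t c Fin.≟ t′

    Star-JointStep⁺ : ∀ {m u m′} → Reach M m u m′ → ∀ t → Star JointStep (m , t) (m′ , δ* T t u)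
    Star-JointStep⁺ reach-[]               t = ε
    Star-JointStep⁺ (reach-∷ {a = c} e ρ) t = (c , e , refl) ◅ Star-JointStep⁺ ρ (DBA.δ T t c)

    Star-JointStep⁻ : ∀ {x y} → Star JointStep x y →
      ∃ λ u → Reach M (proj₁ x) u (proj₁ y) × δ* T (proj₂ x) u ≡ proj₂ y
    Star-JointStep⁻ ε = [] , reach-[] , refl
    Star-JointStep⁻ ((c , e , step) ◅ steps) with Star-JointStep⁻ steps
    ... | u , ρ , eq = c ∷ u , reach-∷ e ρ , trans (cong (λ t → δ* T t u) step) eq

    Realizable : Fin (NBA.states M) → Fin (DBA.states T) → Set
    Realizable q p = ∃ λ u → Lq0 M q u × δ* T (DBA.init T) u ≡ p

    Realizable? : ∀ q p → Dec (Realizable q p)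
    Realizable? q p =
      map′ Star-JointStep⁻ (λ (u , ρ , eq) → subst (Star JointStep _ ∘ (q ,_)) eq (Star-JointStep⁺ ρ _))
           (Star?-↔ *↔× JointStep? (NBA.q₀ M , DBA.init T) (q , p))

    Realizable-loop : ∀ {q p x} → Realizable q p → Reach M q x q → Realizable q (δ* T p x)
    Realizable-loop {x = x} (u , ρ , refl) ρ′ = u ++ x , Reach-++ ρ ρ′ , δ*-++ T (DBA.init T) u x

seg-++ : ∀ {A : Set} (v : ℕ → List A) i l m → seg v i (l + m) ≡ seg v i l ++ seg v (i + l) m
seg-++ v i zero    m = cong (λ j → seg v j m) (sym (+-identityʳ i))
seg-++ v i (suc l) m = begin
  v i ++ seg v (suc i) (l + m)                   ≡⟨ cong (v i ++_) (seg-++ v (suc i) l m) ⟩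
  v i ++ (seg v (suc i) l ++ seg v (suc i + l) m) ≡⟨ sym (++-assoc (v i) _ _) ⟩
  (v i ++ seg v (suc i) l) ++ seg v (suc i + l) m ≡⟨ cong (λ j → (v i ++ seg v (suc i) l) ++ seg v j m) (sym (+-suc i l)) ⟩
  (v i ++ seg v (suc i) l) ++ seg v (i + suc l) m ∎
  where open ≡-Reasoning

seg-infixWord : ∀ {A : Set} (v : ℕ → List A) {a c} → a < c →
  seg v 1 c ≡ seg v 1 a ++ infixWord v (suc a) c
seg-infixWord v {a} {c} a<c = begin
  seg v 1 c                               ≡⟨ cong (seg v 1) c≡a+d ⟩
  seg v 1 (a + suc (c ∸ suc a))           ≡⟨ seg-++ v 1 a (suc (c ∸ suc a)) ⟩
  seg v 1 a ++ infixWord v (suc a) c      ∎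
  where
  open ≡-Reasoning
  c≡a+d : c ≡ a + suc (c ∸ suc a)
  c≡a+d = sym (trans (+-suc a (c ∸ suc a)) (m+[n∸m]≡n a<c))

++-List⁺ : ∀ {A : Set} (x : List A) → ¬ x ≡ [] → ∀ y → ∃ λ w → toList w ≡ x ++ y
++-List⁺ []      x≢[] y = ⊥-elim (x≢[] refl)
++-List⁺ (c ∷ x) _    y = c ∷ (x ++ y) , refl

pigeonhole-ℕ : ∀ {m n} → m ≤ n → (f : ℕ → Fin m) → ∃₂ λ a c → a < c × c ≤ n × f a ≡ f c
pigeonhole-ℕ m≤n f with pigeonhole (s≤s m≤n) (f ∘ toℕ)
... | i , j , i<j , fi≡fj = toℕ i , toℕ j , i<j , ≤-pred (toℕ<n j) , fi≡fj

-- The lasso argument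

module _ {k : ℕ} (M : NBA k) (q : Fin (NBA.states M)) (T : DBA k) {n : ℕ} (v : ℕ → List (Fin k))
         (v-loops : ∀ i → 1 ≤ i → i ≤ n → Lqq M q (v i)) where

  seg-loops : ∀ i l → 1 ≤ i → i + l ≤ suc n → Reach M q (seg v i l) q
  seg-loops i zero    _   _   = reach-[]
  seg-loops i (suc l) 1≤i i+l≤ =
    Reach-++ M (proj₁ (v-loops i 1≤i (m+n≤o⇒m≤o i (≤-pred i+l≤′)))) (seg-loops (suc i) l (s≤s z≤n) i+l≤′)
    where
    i+l≤′ : suc (i + l) ≤ suc n
    i+l≤′ = subst (_≤ suc n) (+-suc i l) i+l≤

  record Lasso (p : Fin (DBA.states T)) : Set where
    field
      a c     : ℕ
      a<c     : a < c
      c≤n     : c ≤ n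
      loop    : List⁺ (Fin k)
      loop≡   : toList loop ≡ infixWord v (suc a) c
      returns : δ* T (δ* T p (seg v 1 a)) (toList loop) ≡ δ* T p (seg v 1 a)

    stem : List (Fin k)
    stem = seg v 1 a

    head : Fin (DBA.states T)
    head = δ* T p stem

    stem-loops : Reach M q stem q
    stem-loops = seg-loops 1 a (s≤s z≤n) (s≤s (<⇒≤ (<-≤-trans a<c c≤n)))

    seg≡stem++loop++ : seg v 1 n ≡ (stem ++ toList loop) ++ seg v (suc c) (n ∸ c)
    seg≡stem++loop++ = begin
      seg v 1 n                               ≡⟨ cong (seg v 1) (sym (m+[n∸m]≡n c≤n)) ⟩
      seg v 1 (c + (n ∸ c))                   ≡⟨ seg-++ v 1 c (n ∸ c) ⟩
      seg v 1 c ++ rest                       ≡⟨ cong (_++ rest) (seg-infixWord v a<c) ⟩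
      (stem ++ infixWord v (suc a) c) ++ rest ≡⟨ cong (λ w → (stem ++ w) ++ rest) (sym loop≡) ⟩
      (stem ++ toList loop) ++ rest           ∎
      where
      open ≡-Reasoning
      rest : List (Fin k)
      rest = seg v (suc c) (n ∸ c)

    LoopVisits : Set
    LoopVisits = Visits T head (toList loop)

    LoopVisits? : Dec LoopVisits
    LoopVisits? = Visits? T head (toList loop)

    Visits-seg : LoopVisits → Visits T p (seg v 1 n)
    Visits-seg visits = subst (Visits T p) (sym seg≡stem++loop++)
      (Visits-++⁺ˡ T (stem ++ toList loop) _ (Visits-++⁺ʳ T stem (toList loop) visits))

  lasso : DBA.states T ≤ n → ∀ p → Lasso p
  lasso B≤n p with pigeonhole-ℕ B≤n (λ l → δ* T p (seg v 1 l))
  ... | a , c , a<c , c≤n , same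
    with ++-List⁺ (v (suc a)) (proj₂ (v-loops (suc a) (s≤s z≤n) (<-≤-trans a<c c≤n))) (seg v (suc (suc a)) (c ∸ suc a))
  ... | loop , loop≡ = record
    { a = a ; c = c ; a<c = a<c ; c≤n = c≤n ; loop = loop ; loop≡ = loop≡ ; returns = returns }
    where
    open ≡-Reasoning
    returns : δ* T (δ* T p (seg v 1 a)) (toList loop) ≡ δ* T p (seg v 1 a)
    returns = begin
      δ* T (δ* T p (seg v 1 a)) (toList loop)             ≡⟨ cong (δ* T (δ* T p (seg v 1 a))) loop≡ ⟩
      δ* T (δ* T p (seg v 1 a)) (infixWord v (suc a) c)   ≡⟨ sym (δ*-++ T p (seg v 1 a) _) ⟩
      δ* T p (seg v 1 a ++ infixWord v (suc a) c)         ≡⟨ cong (δ* T p) (sym (seg-infixWord v a<c)) ⟩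
      δ* T p (seg v 1 c)                                  ≡⟨ sym same ⟩
      δ* T p (seg v 1 a)                                  ∎

  lasso-counterexample : ∀ {p} (ℓ : Lasso p) → Realizable M T q p → ¬ Lasso.LoopVisits ℓ →
    NonemptyMinus (Lq0 M q ·ω (⟦ infixWord v (suc (Lasso.a ℓ)) (Lasso.c ℓ) ⟧ ^ω)) T
  lasso-counterexample ℓ (u , ρ , refl) ¬visits =
    (u ++ stem) ++ω cycle loop ,
    (u ++ stem , cycle loop , Reach-++ M ρ stem-loops , ((λ _ → loop) , (λ _ → loop≡) , λ _ → refl) , λ _ → refl) ,
    rejected
    where
    open Lasso ℓ
    rejected : ¬ Accepts T ((u ++ stem) ++ω cycle loop)
    rejected acc with Accepts-++ω⁻ T (DBA.init T) (u ++ stem) (cycle loop) acc 0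
    ... | i , _ , accepting = cycle-rejects T loop returns ¬visits i
      (subst (λ r → Accepting T (run (startAt T r) (cycle loop) i)) (δ*-++ T (DBA.init T) u stem) accepting)

  loops-visit⇒accepts : 1 ≤ n → (ℓ : ∀ p → Lasso p) → (∀ p → Realizable M T q p → Lasso.LoopVisits (ℓ p)) →
    ∀ {α} → (Lq0 M q ·ω ((infixWord v 1 n · Lqq M q) ^ω)) α → Accepts T α
  loops-visit⇒accepts 1≤n ℓ visits (u , β , ρ , (s , s∈ , β≗) , α≗) =
    Accepts-cong T (sym ∘ α≗)
      (Accepts-++ω⁺ T (DBA.init T) u β
        (Accepts-cong (startAt T _) (sym ∘ β≗)
          (accepts-blocks T (Realizable M T q) s block-realizable block-visits (u , ρ , refl))))
    where
    block≡ : ∀ m → ∃ λ y → Lqq M q y × toList (s m) ≡ seg v 1 n ++ y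
    block≡ m with s∈ m
    ... | y , y∈ , eq = y , y∈ , trans eq (cong (λ l → seg v 1 l ++ y) (m+[n∸m]≡n 1≤n))
    block-realizable : ∀ m {p} → Realizable M T q p → Realizable M T q (δ* T p (toList (s m)))
    block-realizable m {p} real with block≡ m
    ... | y , (ρy , _) , eq = subst (Realizable M T q ∘ δ* T p) (sym eq)
      (Realizable-loop M T real (Reach-++ M (seg-loops 1 n (s≤s z≤n) ≤-refl) ρy))
    block-visits : ∀ m {p} → Realizable M T q p → Visits T p (toList (s m))
    block-visits m {p} real with block≡ m
    ... | y , _ , eq = subst (Visits T p) (sym eq)
      (Visits-++⁺ˡ T (seg v 1 n) y (Lasso.Visits-seg (ℓ p) (visits p real)))

lemma7p9 : ∀ {k : ℕ} (M : NBA k) (q : Fin (NBA.states M)) → NBA.F M q ≡ true →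
    (T : DBA k) (n : ℕ) (v : ℕ → List (Fin k)) →
    (∀ i → 1 ≤ i → i ≤ n → Lqq M q (v i)) →
    NonemptyMinus (Lq0 M q ·ω ((infixWord v 1 n · Lqq M q) ^ω)) T →
    DBA.states T < n →
    ∃ λ i → ∃ λ j → 1 ≤ i × i ≤ j × j ≤ n ×
    NonemptyMinus (Lq0 M q ·ω (⟦ infixWord v i j ⟧ ^ω)) T
lemma7p9 M q _ T n v v-loops (α , α∈ , α∉) B<n
  with any? (λ p → Realizable? M T q p ×-dec ¬? (Lasso.LoopVisits? (lasso M q T v v-loops (<⇒≤ B<n) p)))
... | yes (p , real , ¬visits) = suc a , c , s≤s z≤n , a<c , c≤n , lasso-counterexample M q T v v-loops ℓ real ¬visits
  where
  ℓ : Lasso M q T v v-loops p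
  ℓ = lasso M q T v v-loops (<⇒≤ B<n) p
  open Lasso ℓ
... | no none = ⊥-elim (α∉ (loops-visit⇒accepts M q T v v-loops 1≤n ℓ loop-visits α∈))
  where
  1≤n : 1 ≤ n
  1≤n = ≤-trans (s≤s z≤n) B<n
  ℓ : ∀ p → Lasso M q T v v-loops p
  ℓ = lasso M q T v v-loops (<⇒≤ B<n)
  loop-visits : ∀ p → Realizable M T q p → Lasso.LoopVisits (ℓ p)
  loop-visits p real = decidable-stable (Lasso.LoopVisits? (ℓ p)) λ ¬visits → none (p , real , ¬visits)
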